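{- If $M$ is a matroid then $T^2_M(1-t,1;0,0)=t^{\mathrm{rk}(M)}\chi^{op}_M(t^{ -1})$.
   Context: For a matroid $M$ on ground set $\mathcal{A}$ with rank function $\mathrm{rk}$, $T^2_M(x_1,x_2;y_1,y_2)=\sum_{S_1\subseteq S_2\subseteq\mathcal{A}}\prod_{i=1}^2(x_i-1)^{\mathrm{rk}(\mathcal{A})-\mathrm{rk}(S_i)}(y_i-1)^{|S_i|-\mathrm{rk}(S_i)}$. Let $L(M)$ be the lattice of flats with top element $\hat 1$, and $L(M)^{op}$ the same set with reversed order. The opposite characteristic polynomial is the characteristic polynomial of $L(M)^{op}$: $\chi^{op}_M(t)=\sum_{x\in L(M)^{op}}\mu^{op}(\hat1,x)t^{\mathrm{crk}^{op}(x)}$, where $\mu^{op}$ is the Möbius function of $L(M)^{op}$ and $\mathrm{crk}^{op}$ the corank in $L(M)^{op}$; equivalently $\chi^{op}_M(t)=\sum_{X\in L(M)}\mu(X,\hat1)t^{\mathrm{rk}(X)}$ with $\mu$ the Möbius function of $L(M)$. -}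

module Defs where

open import Data.Nat as ℕ using (ℕ; zero; suc; _∸_)
open import Data.Fin using (Fin)
open import Data.Fin.Subset using (Subset; _⊆_; _⊂_; _∪_; _∩_; ⊥; ⊤; ∣_∣; ⁅_⁆; _∈_; _∉_; inside; outside)
open import Data.Fin.Subset.Properties using (_⊆?_; _⊂?_)
open import Data.Vec using (Vec; []; _∷_)
open import Data.List as List using (List; []; _∷_; _++_; map; filter; concatMap)
open import Data.Rational using (ℚ; 0ℚ; 1ℚ; _+_; _*_; _-_; -_)
open import Data.Integer using (ℤ)
import Data.Integer as ℤ
open import Data.Rational using () renaming (_/_ to _/ℚ_)
open import Relation.Nullary using (Dec; yes; no; ¬_)
open import Relation.Unary using (Decidable)
open import Relation.Binary.PropositionalEquality using (_≡_)
open import Data.Product using (_×_; _,_)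

record Matroid (n : ℕ) : Set where
  field
    rk          : Subset n → ℕ
    rk-bounded  : ∀ X → rk X ℕ.≤ ∣ X ∣
    rk-mono     : ∀ {X Y} → X ⊆ Y → rk X ℕ.≤ rk Y
    rk-submod   : ∀ X Y → rk (X ∪ Y) ℕ.+ rk (X ∩ Y) ℕ.≤ rk X ℕ.+ rk Y

open Matroid public

rank : ∀ {n} → Matroid n → ℕ
rank M = rk M ⊤

allSubsets : (n : ℕ) → List (Subset n)
allSubsets zero    = [] ∷ []
allSubsets (suc n) = map (outside ∷_) (allSubsets n) ++ map (inside ∷_) (allSubsets n)

sumℚ : List ℚ → ℚ
sumℚ = List.foldr _+_ 0ℚ

-- Powers in ℚ with the convention x ^ 0 = 1 (in particular 0 ^ 0 = 1).
_^_ : ℚ → ℕ → ℚ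
x ^ zero  = 1ℚ
x ^ suc k = x * (x ^ k)

ℤtoℚ : ℤ → ℚ
ℤtoℚ z = z /ℚ 1

IsFlat : ∀ {n} → Matroid n → Subset n → Set
IsFlat {n} M X = ∀ (e : Fin n) → e ∉ X → rk M X ℕ.< rk M (X ∪ ⁅ e ⁆)

open import Data.Fin.Subset.Properties using (_∈?_)
open import Data.Fin.Properties using (all?)
open import Relation.Nullary.Decidable using (_→-dec_; ¬?)

isFlat? : ∀ {n} (M : Matroid n) → Decidable (IsFlat M)
isFlat? M X = all? (λ e → ¬? (e ∈? X) →-dec (rk M X ℕ.<? rk M (X ∪ ⁅ e ⁆)))

flats : ∀ {n} → Matroid n → List (Subset n)
flats {n} M = filter (isFlat? M) (allSubsets n)

-- Möbius function μ(X, 1̂) of the lattice of flats L(M), where 1̂ = 𝒜 = ⊤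
-- (the closure of the ground set).
-- The recursion is on the fuel parameter; fuel n is always sufficient,
-- since each step strictly enlarges the subset.

μ-fuel : ∀ {n} → Matroid n → ℕ → Subset n → ℤ
μ-fuel M zero    X = ℤ.1ℤ
μ-fuel M (suc k) X with X ⊂? ⊤
... | no  _ = ℤ.1ℤ
... | yes _ = ℤ.- List.foldr ℤ._+_ ℤ.0ℤ
                   (map (μ-fuel M k) (filter (X ⊂?_) (flats M)))

μTop : ∀ {n} → Matroid n → Subset n → ℤ
μTop {n} M X = μ-fuel M n X

χop : ∀ {n} → Matroid n → ℚ → ℚ
χop M s = sumℚ (map (λ X → ℤtoℚ (μTop M X) * (s ^ rk M X)) (flats M))

chains₂ : (n : ℕ) → List (Subset n × Subset n)
chains₂ n = concatMap (λ S₂ → map (λ S₁ → (S₁ , S₂)) (filter (_⊆? S₂) (allSubsets n))) (allSubsets n)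

T² : ∀ {n} → Matroid n → ℚ → ℚ → ℚ → ℚ → ℚ
T² {n} M x₁ x₂ y₁ y₂ = sumℚ (map term (chains₂ n))
  where
  factor : ℚ → ℚ → Subset n → ℚ
  factor x y S = ((x - 1ℚ) ^ (rank M ∸ rk M S)) * ((y - 1ℚ) ^ (∣ S ∣ ∸ rk M S))
  term : Subset n × Subset n → ℚ
  term (S₁ , S₂) = factor x₁ y₁ S₁ * factor x₂ y₂ S₂

{-# OPTIONS --safe #-}
-- At x₂ = 1 the factor 0 ^ (rk 𝒜 - rk S₂) keeps only spanning S₂, so summing over S₂ ⊇ S₁ gives
--   T²_M(1-t,1;0,0) = Σ_S t^(rk 𝒜 - rk S) μ̂(S),   μ̂(S) = (-1)^|S| Σ_{T ⊇ S spanning} (-1)^|T|.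
-- If S is not a flat, some e ∉ S has rk(S ∪ e) = rk S; toggling e preserves spanning supersets of S
-- and flips their sign, so μ̂(S) = 0. Möbius inversion on the Boolean lattice gives
-- Σ_{Z ⊇ X} μ̂(Z) = [X spanning]; restricted to flats this is the recursion defining μ(X, 1̂),
-- so μ̂ = μ(-, 1̂) on flats and the sum becomes t^rk(M) Σ_X μ(X, 1̂) t^(-rk X).
module Submission where

open import Defs
open import Data.Nat as ℕ using (ℕ; zero; suc; _∸_)
import Data.Nat.Properties as ℕ
open import Data.Fin using (Fin; zero; suc)
open import Data.Fin.Subset using (Subset; outside; inside; _⊆_; _⊂_; _∈_; _∉_; _∪_; _∩_; ⁅_⁆; ⊤; ∣_∣)
open import Data.Fin.Subset.Properties
  using (_⊆?_; _⊂?_; _∈?_; drop-∷-⊆; out⊆; in⊆in; ⊆⊤; ⊆-antisym; ⊆-refl; ⊂-irref; ∣p∣≤n; ∣p∣≡n⇒p≡⊤; p⊂q⇒∣p∣<∣q∣;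
         p⊆p∪q; x∈p∪q⁻; x∈p∪q⁺; x∈p∩q⁺)
open import Data.Fin.Properties using (¬∀⟶∃¬)
open import Data.Vec using ([]; _∷_; here; there)
open import Data.List using (List; []; _∷_; _++_; map; filter; concatMap; foldr)
open import Data.List.Properties using (map-++; map-∘; map-cong-local)
import Data.List.Relation.Unary.All as All
open import Data.List.Membership.Propositional using () renaming (_∈_ to _∈ₗ_)
open import Data.List.Membership.Propositional.Properties using (∈-filter⁻)
open import Data.Rational using (ℚ; mkℚ; 0ℚ; 1ℚ; ½; _+_; _*_; _-_; -_; _/_; NonZero; 1/_)
import Data.Rational.Properties as ℚ
open import Data.Rational.Solver using (module +-*-Solver)
open +-*-Solver using (solve; _:=_; _:+_; _:*_; :-_; _:-_; con)
open import Algebra.Bundles using (CommutativeMonoid)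
open import Algebra.Properties.CommutativeSemigroup (CommutativeMonoid.commutativeSemigroup ℚ.+-0-commutativeMonoid)
  using (interchange)
open import Data.Integer as ℤ using (ℤ)
import Data.Integer.Properties as ℤ
import Data.Nat.Coprimality as Coprime
open import Data.Product using (∃; _×_; _,_; proj₁; proj₂)
open import Data.Sum using (inj₁; inj₂)
open import Data.Empty using (⊥-elim)
open import Function using (_∘_)
open import Level using (Level)
open import Data.Bool using (not)
open import Relation.Nullary using (Dec; yes; no; ¬_)
open import Relation.Nullary.Decidable using (_→-dec_; ¬?)
open import Relation.Binary.PropositionalEquality
open ≡-Reasoning

𝟙 : ∀ {p} {P : Set p} → Dec P → ℚ
𝟙 (yes _) = 1ℚ
𝟙 (no _)  = 0ℚ

sumℚ-++ : ∀ xs ys → sumℚ (xs ++ ys) ≡ sumℚ xs + sumℚ ys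
sumℚ-++ []       ys = sym (ℚ.+-identityˡ _)
sumℚ-++ (x ∷ xs) ys = trans (cong (x +_) (sumℚ-++ xs ys)) (sym (ℚ.+-assoc x _ _))

private variable
  a b : Level
  A : Set a
  B : Set b

sumℚ-filter : ∀ {p} {P : A → Set p} (P? : ∀ x → Dec (P x)) (f : A → ℚ) xs →
              sumℚ (map f (filter P? xs)) ≡ sumℚ (map (λ x → 𝟙 (P? x) * f x) xs)
sumℚ-filter P? f []       = refl
sumℚ-filter P? f (x ∷ xs) with P? x
... | yes _ = cong₂ _+_ (sym (ℚ.*-identityˡ (f x))) (sumℚ-filter P? f xs)
... | no  _ = trans (sumℚ-filter P? f xs) (sym (trans (cong (_+ _) (ℚ.*-zeroˡ (f x))) (ℚ.+-identityˡ _)))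

sumℚ-concatMap : ∀ (f : B → ℚ) (g : A → List B) xs →
                 sumℚ (map f (concatMap g xs)) ≡ sumℚ (map (λ x → sumℚ (map f (g x))) xs)
sumℚ-concatMap f g []       = refl
sumℚ-concatMap f g (x ∷ xs) = begin
  sumℚ (map f (g x ++ concatMap g xs))
    ≡⟨ cong sumℚ (map-++ f (g x) _) ⟩
  sumℚ (map f (g x) ++ map f (concatMap g xs))
    ≡⟨ sumℚ-++ (map f (g x)) _ ⟩
  sumℚ (map f (g x)) + sumℚ (map f (concatMap g xs))
    ≡⟨ cong (sumℚ (map f (g x)) +_) (sumℚ-concatMap f g xs) ⟩
  sumℚ (map (λ x → sumℚ (map f (g x))) (x ∷ xs)) ∎

-- Sums over the subsets of Fin n

Σₛ : ∀ {n} → (Subset n → ℚ) → ℚ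
Σₛ {zero}  f = f []
Σₛ {suc n} f = Σₛ (f ∘ (outside ∷_)) + Σₛ (f ∘ (inside ∷_))

sumℚ-allSubsets : ∀ n (f : Subset n → ℚ) → sumℚ (map f (allSubsets n)) ≡ Σₛ f
sumℚ-allSubsets zero    f = ℚ.+-identityʳ (f [])
sumℚ-allSubsets (suc n) f = begin
  sumℚ (map f (map (outside ∷_) Sₙ ++ map (inside ∷_) Sₙ))
    ≡⟨ cong sumℚ (map-++ f (map (outside ∷_) Sₙ) _) ⟩
  sumℚ (map f (map (outside ∷_) Sₙ) ++ map f (map (inside ∷_) Sₙ))
    ≡⟨ sumℚ-++ (map f (map (outside ∷_) Sₙ)) _ ⟩
  sumℚ (map f (map (outside ∷_) Sₙ)) + sumℚ (map f (map (inside ∷_) Sₙ))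
    ≡⟨ cong₂ _+_ (cong sumℚ (sym (map-∘ Sₙ))) (cong sumℚ (sym (map-∘ Sₙ))) ⟩
  sumℚ (map (f ∘ (outside ∷_)) Sₙ) + sumℚ (map (f ∘ (inside ∷_)) Sₙ)
    ≡⟨ cong₂ _+_ (sumℚ-allSubsets n _) (sumℚ-allSubsets n _) ⟩
  Σₛ f ∎
  where Sₙ = allSubsets n

Σₛ-cong : ∀ {n} {f g : Subset n → ℚ} → (∀ S → f S ≡ g S) → Σₛ f ≡ Σₛ g
Σₛ-cong {zero}  f≗g = f≗g []
Σₛ-cong {suc n} f≗g = cong₂ _+_ (Σₛ-cong (f≗g ∘ (outside ∷_))) (Σₛ-cong (f≗g ∘ (inside ∷_)))

Σₛ-zero : ∀ {n} {f : Subset n → ℚ} → (∀ S → f S ≡ 0ℚ) → Σₛ f ≡ 0ℚ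
Σₛ-zero {zero}  f≗0 = f≗0 []
Σₛ-zero {suc n} f≗0 = cong₂ _+_ (Σₛ-zero (f≗0 ∘ (outside ∷_))) (Σₛ-zero (f≗0 ∘ (inside ∷_)))

Σₛ-+ : ∀ {n} (f g : Subset n → ℚ) → Σₛ (λ S → f S + g S) ≡ Σₛ f + Σₛ g
Σₛ-+ {zero}  f g = refl
Σₛ-+ {suc n} f g = begin
  Σₛ (λ S → f (outside ∷ S) + g (outside ∷ S)) + Σₛ (λ S → f (inside ∷ S) + g (inside ∷ S))
    ≡⟨ cong₂ _+_ (Σₛ-+ (f ∘ (outside ∷_)) (g ∘ (outside ∷_))) (Σₛ-+ (f ∘ (inside ∷_)) (g ∘ (inside ∷_))) ⟩
  (Σₛ (f ∘ (outside ∷_)) + Σₛ (g ∘ (outside ∷_))) + (Σₛ (f ∘ (inside ∷_)) + Σₛ (g ∘ (inside ∷_)))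
    ≡⟨ interchange (Σₛ (f ∘ (outside ∷_))) (Σₛ (g ∘ (outside ∷_))) (Σₛ (f ∘ (inside ∷_))) _ ⟩
  Σₛ f + Σₛ g ∎

Σₛ-*ˡ : ∀ {n} (c : ℚ) (f : Subset n → ℚ) → Σₛ (λ S → c * f S) ≡ c * Σₛ f
Σₛ-*ˡ {zero}  c f = refl
Σₛ-*ˡ {suc n} c f =
  trans (cong₂ _+_ (Σₛ-*ˡ c (f ∘ (outside ∷_))) (Σₛ-*ˡ c (f ∘ (inside ∷_)))) (sym (ℚ.*-distribˡ-+ c _ _))

Σₛ-comm : ∀ {n} (F : Subset n → Subset n → ℚ) → Σₛ (λ A → Σₛ (F A)) ≡ Σₛ (λ B → Σₛ (λ A → F A B))
Σₛ-comm {zero}  F = refl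
Σₛ-comm {suc n} F = begin
  Σₛ (λ A → Σₛ (F₀₀ A) + Σₛ (F₀₁ A)) + Σₛ (λ A → Σₛ (F₁₀ A) + Σₛ (F₁₁ A))
    ≡⟨ cong₂ _+_ (Σₛ-+ (Σₛ ∘ F₀₀) (Σₛ ∘ F₀₁)) (Σₛ-+ (Σₛ ∘ F₁₀) (Σₛ ∘ F₁₁)) ⟩
  (Σₛ (Σₛ ∘ F₀₀) + Σₛ (Σₛ ∘ F₀₁)) + (Σₛ (Σₛ ∘ F₁₀) + Σₛ (Σₛ ∘ F₁₁))
    ≡⟨ cong₂ _+_ (cong₂ _+_ (Σₛ-comm F₀₀) (Σₛ-comm F₀₁)) (cong₂ _+_ (Σₛ-comm F₁₀) (Σₛ-comm F₁₁)) ⟩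
  (Σₛ (Σₛ ∘ G₀₀) + Σₛ (Σₛ ∘ G₀₁)) + (Σₛ (Σₛ ∘ G₁₀) + Σₛ (Σₛ ∘ G₁₁))
    ≡⟨ interchange (Σₛ (Σₛ ∘ G₀₀)) (Σₛ (Σₛ ∘ G₀₁)) (Σₛ (Σₛ ∘ G₁₀)) _ ⟩
  (Σₛ (Σₛ ∘ G₀₀) + Σₛ (Σₛ ∘ G₁₀)) + (Σₛ (Σₛ ∘ G₀₁) + Σₛ (Σₛ ∘ G₁₁))
    ≡⟨ sym (cong₂ _+_ (Σₛ-+ (Σₛ ∘ G₀₀) (Σₛ ∘ G₁₀)) (Σₛ-+ (Σₛ ∘ G₀₁) (Σₛ ∘ G₁₁))) ⟩
  Σₛ (λ B → Σₛ (λ A → F A B)) ∎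
  where
  F₀₀ F₀₁ F₁₀ F₁₁ G₀₀ G₀₁ G₁₀ G₁₁ : Subset n → Subset n → ℚ
  F₀₀ A B = F (outside ∷ A) (outside ∷ B)
  F₀₁ A B = F (outside ∷ A) (inside ∷ B)
  F₁₀ A B = F (inside ∷ A) (outside ∷ B)
  F₁₁ A B = F (inside ∷ A) (inside ∷ B)
  G₀₀ B A = F₀₀ A B
  G₀₁ B A = F₀₁ A B
  G₁₀ B A = F₁₀ A B
  G₁₁ B A = F₁₁ A B

toggle : ∀ {n} → Fin n → Subset n → Subset n
toggle zero    (x ∷ S) = not x ∷ S
toggle (suc e) (x ∷ S) = x ∷ toggle e S

Σₛ-toggle : ∀ {n} (e : Fin n) (f : Subset n → ℚ) → Σₛ (f ∘ toggle e) ≡ Σₛ f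
Σₛ-toggle zero    f = ℚ.+-comm (Σₛ (f ∘ (inside ∷_))) (Σₛ (f ∘ (outside ∷_)))
Σₛ-toggle (suc e) f = cong₂ _+_ (Σₛ-toggle e (f ∘ (outside ∷_))) (Σₛ-toggle e (f ∘ (inside ∷_)))

∈-toggle⁺ : ∀ {n} {x e : Fin n} {S : Subset n} → x ≢ e → x ∈ S → x ∈ toggle e S
∈-toggle⁺ {x = zero}  {zero}           x≢e _           = ⊥-elim (x≢e refl)
∈-toggle⁺ {x = zero}  {suc e} {_ ∷ S} _   here        = here
∈-toggle⁺ {x = suc x} {zero}  {_ ∷ S} _   (there x∈S) = there x∈S
∈-toggle⁺ {x = suc x} {suc e} {_ ∷ S} x≢e (there x∈S) = there (∈-toggle⁺ (x≢e ∘ cong suc) x∈S)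

⊆-toggle : ∀ {n} {e : Fin n} {A S : Subset n} → e ∉ A → A ⊆ S → A ⊆ toggle e S
⊆-toggle e∉A A⊆S x∈A = ∈-toggle⁺ (λ { refl → e∉A x∈A }) (A⊆S x∈A)

toggle-∪-⁅⁆ : ∀ {n} (e : Fin n) (S : Subset n) → toggle e S ∪ ⁅ e ⁆ ≡ S ∪ ⁅ e ⁆
toggle-∪-⁅⁆ zero    (outside ∷ S) = refl
toggle-∪-⁅⁆ zero    (inside ∷ S)  = refl
toggle-∪-⁅⁆ (suc e) (x ∷ S)       = cong (_ ∷_) (toggle-∪-⁅⁆ e S)

-- Defined by recursion rather than via _⊆?_, so that they split along Σₛ

⟦_⊆_⟧ : ∀ {n} → Subset n → Subset n → ℚ
⟦ []          ⊆ []          ⟧ = 1ℚ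
⟦ outside ∷ X ⊆ _ ∷ Z       ⟧ = ⟦ X ⊆ Z ⟧
⟦ inside ∷ X  ⊆ outside ∷ Z ⟧ = 0ℚ
⟦ inside ∷ X  ⊆ inside ∷ Z  ⟧ = ⟦ X ⊆ Z ⟧

⟦_≡_⟧ : ∀ {n} → Subset n → Subset n → ℚ
⟦ []          ≡ []          ⟧ = 1ℚ
⟦ outside ∷ X ≡ outside ∷ Z ⟧ = ⟦ X ≡ Z ⟧
⟦ outside ∷ X ≡ inside ∷ Z  ⟧ = 0ℚ
⟦ inside ∷ X  ≡ outside ∷ Z ⟧ = 0ℚ
⟦ inside ∷ X  ≡ inside ∷ Z  ⟧ = ⟦ X ≡ Z ⟧

⟦⊆⟧-yes : ∀ {n} {X Z : Subset n} → X ⊆ Z → ⟦ X ⊆ Z ⟧ ≡ 1ℚ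
⟦⊆⟧-yes {X = []}          {[]}          _   = refl
⟦⊆⟧-yes {X = outside ∷ X} {_ ∷ Z}       X⊆Z = ⟦⊆⟧-yes (drop-∷-⊆ X⊆Z)
⟦⊆⟧-yes {X = inside ∷ X}  {outside ∷ Z} X⊆Z with () ← X⊆Z here
⟦⊆⟧-yes {X = inside ∷ X}  {inside ∷ Z}  X⊆Z = ⟦⊆⟧-yes (drop-∷-⊆ X⊆Z)

⟦⊆⟧-no : ∀ {n} {X Z : Subset n} → ¬ X ⊆ Z → ⟦ X ⊆ Z ⟧ ≡ 0ℚ
⟦⊆⟧-no {X = []}          {[]}          X⊈Z = ⊥-elim (X⊈Z (λ ()))
⟦⊆⟧-no {X = outside ∷ X} {_ ∷ Z}       X⊈Z = ⟦⊆⟧-no (X⊈Z ∘ out⊆)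
⟦⊆⟧-no {X = inside ∷ X}  {outside ∷ Z} X⊈Z = refl
⟦⊆⟧-no {X = inside ∷ X}  {inside ∷ Z}  X⊈Z = ⟦⊆⟧-no (X⊈Z ∘ in⊆in)

⟦⊆⟧≡𝟙 : ∀ {n} (X Z : Subset n) → ⟦ X ⊆ Z ⟧ ≡ 𝟙 (X ⊆? Z)
⟦⊆⟧≡𝟙 X Z with X ⊆? Z
... | yes X⊆Z = ⟦⊆⟧-yes X⊆Z
... | no  X⊈Z = ⟦⊆⟧-no X⊈Z

⟦⊆⟧-toggle : ∀ {n} (e : Fin n) (A S : Subset n) → e ∉ A → ⟦ A ⊆ toggle e S ⟧ ≡ ⟦ A ⊆ S ⟧
⟦⊆⟧-toggle zero    (outside ∷ A) (_ ∷ S)       e∉A = refl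
⟦⊆⟧-toggle zero    (inside ∷ A)  (_ ∷ S)       e∉A = ⊥-elim (e∉A here)
⟦⊆⟧-toggle (suc e) (outside ∷ A) (_ ∷ S)       e∉A = ⟦⊆⟧-toggle e A S (e∉A ∘ there)
⟦⊆⟧-toggle (suc e) (inside ∷ A)  (outside ∷ S) e∉A = refl
⟦⊆⟧-toggle (suc e) (inside ∷ A)  (inside ∷ S)  e∉A = ⟦⊆⟧-toggle e A S (e∉A ∘ there)

⟦⊤⊆⟧≡⟦⊤≡⟧ : ∀ {n} (Z : Subset n) → ⟦ ⊤ ⊆ Z ⟧ ≡ ⟦ ⊤ ≡ Z ⟧
⟦⊤⊆⟧≡⟦⊤≡⟧ []            = refl
⟦⊤⊆⟧≡⟦⊤≡⟧ (outside ∷ Z) = refl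
⟦⊤⊆⟧≡⟦⊤≡⟧ (inside ∷ Z)  = ⟦⊤⊆⟧≡⟦⊤≡⟧ Z

⟦≡⟧-refl : ∀ {n} (X : Subset n) → ⟦ X ≡ X ⟧ ≡ 1ℚ
⟦≡⟧-refl []            = refl
⟦≡⟧-refl (outside ∷ X) = ⟦≡⟧-refl X
⟦≡⟧-refl (inside ∷ X)  = ⟦≡⟧-refl X

⟦≡⟧-≢ : ∀ {n} {X Z : Subset n} → X ≢ Z → ⟦ X ≡ Z ⟧ ≡ 0ℚ
⟦≡⟧-≢ {X = []}          {[]}          X≢Z = ⊥-elim (X≢Z refl)
⟦≡⟧-≢ {X = outside ∷ X} {outside ∷ Z} X≢Z = ⟦≡⟧-≢ (X≢Z ∘ cong (outside ∷_))
⟦≡⟧-≢ {X = outside ∷ X} {inside ∷ Z}  X≢Z = refl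
⟦≡⟧-≢ {X = inside ∷ X}  {outside ∷ Z} X≢Z = refl
⟦≡⟧-≢ {X = inside ∷ X}  {inside ∷ Z}  X≢Z = ⟦≡⟧-≢ (X≢Z ∘ cong (inside ∷_))

Σₛ-⟦≡⟧ : ∀ {n} (X : Subset n) (g : Subset n → ℚ) → Σₛ (λ S → ⟦ X ≡ S ⟧ * g S) ≡ g X
Σₛ-⟦≡⟧ []            g = ℚ.*-identityˡ (g [])
Σₛ-⟦≡⟧ (outside ∷ X) g = begin
  Σₛ (λ S → ⟦ X ≡ S ⟧ * g (outside ∷ S)) + Σₛ (λ S → 0ℚ * g (inside ∷ S))
    ≡⟨ cong₂ _+_ (Σₛ-⟦≡⟧ X (g ∘ (outside ∷_))) (Σₛ-zero (ℚ.*-zeroˡ ∘ g ∘ (inside ∷_))) ⟩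
  g (outside ∷ X) + 0ℚ
    ≡⟨ ℚ.+-identityʳ _ ⟩
  g (outside ∷ X) ∎
Σₛ-⟦≡⟧ (inside ∷ X)  g = begin
  Σₛ (λ S → 0ℚ * g (outside ∷ S)) + Σₛ (λ S → ⟦ X ≡ S ⟧ * g (inside ∷ S))
    ≡⟨ cong₂ _+_ (Σₛ-zero (ℚ.*-zeroˡ ∘ g ∘ (outside ∷_))) (Σₛ-⟦≡⟧ X (g ∘ (inside ∷_))) ⟩
  0ℚ + g (inside ∷ X)
    ≡⟨ ℚ.+-identityˡ _ ⟩
  g (inside ∷ X) ∎

⊆∧⊄⇒≡ : ∀ {n} {X Z : Subset n} → X ⊆ Z → ¬ X ⊂ Z → X ≡ Z
⊆∧⊄⇒≡ {X = X} X⊆Z X⊄Z = ⊆-antisym X⊆Z Z⊆X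
  where
  Z⊆X : _ ⊆ X
  Z⊆X {x} x∈Z with x ∈? X
  ... | yes x∈X = x∈X
  ... | no  x∉X = ⊥-elim (X⊄Z (X⊆Z , x , x∈Z , x∉X))

𝟙⊂?≡⟦⊆⟧-⟦≡⟧ : ∀ {n} (X Z : Subset n) → 𝟙 (X ⊂? Z) ≡ ⟦ X ⊆ Z ⟧ - ⟦ X ≡ Z ⟧
𝟙⊂?≡⟦⊆⟧-⟦≡⟧ X Z with X ⊂? Z | X ⊆? Z
... | yes X⊂Z | _ = sym (cong₂ _-_ (⟦⊆⟧-yes (proj₁ X⊂Z)) (⟦≡⟧-≢ {X = X} {Z} (λ { refl → ⊂-irref refl X⊂Z })))
... | no  X⊄Z | yes X⊆Z = begin
  0ℚ                    ≡⟨ sym (ℚ.+-inverseʳ 1ℚ) ⟩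
  1ℚ - 1ℚ               ≡⟨ sym (cong₂ _-_ (⟦⊆⟧-yes X⊆Z) (trans (cong ⟦ X ≡_⟧ (sym (⊆∧⊄⇒≡ X⊆Z X⊄Z))) (⟦≡⟧-refl X))) ⟩
  ⟦ X ⊆ Z ⟧ - ⟦ X ≡ Z ⟧ ∎
... | no  X⊄Z | no X⊈Z = sym (cong₂ _-_ (⟦⊆⟧-no X⊈Z) (⟦≡⟧-≢ {X = X} {Z} (λ { refl → X⊈Z ⊆-refl })))

Σₛ-neg : ∀ {n} (f : Subset n → ℚ) → Σₛ (λ S → - f S) ≡ - Σₛ f
Σₛ-neg {zero}  f = refl
Σₛ-neg {suc n} f =
  trans (cong₂ _+_ (Σₛ-neg (f ∘ (outside ∷_))) (Σₛ-neg (f ∘ (inside ∷_)))) (sym (ℚ.neg-distrib-+ (Σₛ (f ∘ (outside ∷_))) _))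

Σₛ-*-neg : ∀ {n} (f g : Subset n → ℚ) → Σₛ (λ S → f S * - g S) ≡ - Σₛ (λ S → f S * g S)
Σₛ-*-neg f g = trans (Σₛ-cong (λ S → sym (ℚ.neg-distribʳ-* (f S) (g S)))) (Σₛ-neg (λ S → f S * g S))

x≡-x⇒x≡0 : ∀ x → x ≡ - x → x ≡ 0ℚ
x≡-x⇒x≡0 x x≡-x = begin
  x                  ≡⟨ solve 1 (λ x → x := con ½ :* (x :+ x)) refl x ⟩
  ½ * (x + x)        ≡⟨ cong (λ y → ½ * (x + y)) x≡-x ⟩
  ½ * (x + - x)      ≡⟨ solve 1 (λ x → con ½ :* (x :+ :- x) := con 0ℚ) refl x ⟩
  0ℚ ∎

sign : ∀ {n} → Subset n → ℚ
sign []            = 1ℚ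
sign (outside ∷ S) = sign S
sign (inside ∷ S)  = - sign S

sign-toggle : ∀ {n} (e : Fin n) (S : Subset n) → sign (toggle e S) ≡ - sign S
sign-toggle zero    (outside ∷ S) = refl
sign-toggle zero    (inside ∷ S)  = solve 1 (λ s → s := :- (:- s)) refl (sign S)
sign-toggle (suc e) (outside ∷ S) = sign-toggle e S
sign-toggle (suc e) (inside ∷ S)  = cong -_ (sign-toggle e S)

sign*sign≡1 : ∀ {n} (S : Subset n) → sign S * sign S ≡ 1ℚ
sign*sign≡1 []            = refl
sign*sign≡1 (outside ∷ S) = sign*sign≡1 S
sign*sign≡1 (inside ∷ S)  = trans (solve 1 (λ s → (:- s) :* (:- s) := s :* s) refl (sign S)) (sign*sign≡1 S)

Σₛ-interval-sign : ∀ {n} (X S : Subset n) → Σₛ (λ Z → ⟦ X ⊆ Z ⟧ * ⟦ Z ⊆ S ⟧ * sign Z) ≡ sign S * ⟦ X ≡ S ⟧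
Σₛ-interval-sign []            []            = refl
Σₛ-interval-sign (outside ∷ X) (outside ∷ S) = begin
  Σₛ (λ Z → ⟦ X ⊆ Z ⟧ * ⟦ Z ⊆ S ⟧ * sign Z) + Σₛ (λ Z → ⟦ X ⊆ Z ⟧ * 0ℚ * - sign Z)
    ≡⟨ cong₂ _+_ (Σₛ-interval-sign X S) (Σₛ-zero (λ Z → solve 2 (λ a s → a :* con 0ℚ :* (:- s) := con 0ℚ) refl ⟦ X ⊆ Z ⟧ (sign Z))) ⟩
  sign S * ⟦ X ≡ S ⟧ + 0ℚ
    ≡⟨ ℚ.+-identityʳ _ ⟩
  sign S * ⟦ X ≡ S ⟧ ∎
Σₛ-interval-sign (outside ∷ X) (inside ∷ S)  = begin
  Σₛ (λ Z → ⟦ X ⊆ Z ⟧ * ⟦ Z ⊆ S ⟧ * sign Z) + Σₛ (λ Z → ⟦ X ⊆ Z ⟧ * ⟦ Z ⊆ S ⟧ * - sign Z)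
    ≡⟨ cong (Σₛ (λ Z → ⟦ X ⊆ Z ⟧ * ⟦ Z ⊆ S ⟧ * sign Z) +_) (Σₛ-*-neg (λ Z → ⟦ X ⊆ Z ⟧ * ⟦ Z ⊆ S ⟧) sign) ⟩
  Σₛ (λ Z → ⟦ X ⊆ Z ⟧ * ⟦ Z ⊆ S ⟧ * sign Z) - Σₛ (λ Z → ⟦ X ⊆ Z ⟧ * ⟦ Z ⊆ S ⟧ * sign Z)
    ≡⟨ ℚ.+-inverseʳ (Σₛ (λ Z → ⟦ X ⊆ Z ⟧ * ⟦ Z ⊆ S ⟧ * sign Z)) ⟩
  0ℚ
    ≡⟨ sym (ℚ.*-zeroʳ (- sign S)) ⟩
  - sign S * 0ℚ ∎
Σₛ-interval-sign (inside ∷ X)  (outside ∷ S) = begin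
  Σₛ (λ Z → 0ℚ * ⟦ Z ⊆ S ⟧ * sign Z) + Σₛ (λ Z → ⟦ X ⊆ Z ⟧ * 0ℚ * - sign Z)
    ≡⟨ cong₂ _+_ (Σₛ-zero (λ Z → solve 2 (λ a s → con 0ℚ :* a :* s := con 0ℚ) refl ⟦ Z ⊆ S ⟧ (sign Z)))
                 (Σₛ-zero (λ Z → solve 2 (λ a s → a :* con 0ℚ :* (:- s) := con 0ℚ) refl ⟦ X ⊆ Z ⟧ (sign Z))) ⟩
  0ℚ + 0ℚ
    ≡⟨ sym (ℚ.*-zeroʳ (sign S)) ⟩
  sign S * 0ℚ ∎
Σₛ-interval-sign (inside ∷ X)  (inside ∷ S)  = begin
  Σₛ (λ Z → 0ℚ * ⟦ Z ⊆ S ⟧ * sign Z) + Σₛ (λ Z → ⟦ X ⊆ Z ⟧ * ⟦ Z ⊆ S ⟧ * - sign Z)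
    ≡⟨ cong₂ _+_ (Σₛ-zero (λ Z → solve 2 (λ a s → con 0ℚ :* a :* s := con 0ℚ) refl ⟦ Z ⊆ S ⟧ (sign Z)))
                 (Σₛ-*-neg (λ Z → ⟦ X ⊆ Z ⟧ * ⟦ Z ⊆ S ⟧) sign) ⟩
  0ℚ - Σₛ (λ Z → ⟦ X ⊆ Z ⟧ * ⟦ Z ⊆ S ⟧ * sign Z)
    ≡⟨ cong (λ s → 0ℚ - s) (Σₛ-interval-sign X S) ⟩
  0ℚ - sign S * ⟦ X ≡ S ⟧
    ≡⟨ solve 2 (λ s d → con 0ℚ :- s :* d := (:- s) :* d) refl (sign S) ⟦ X ≡ S ⟧ ⟩
  - sign S * ⟦ X ≡ S ⟧ ∎

-- Möbius inversion on the Boolean lattice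

upperMöbius : ∀ {n} → (Subset n → ℚ) → Subset n → ℚ
upperMöbius g A = sign A * Σₛ (λ S → ⟦ A ⊆ S ⟧ * (g S * sign S))

Σₛ-⊆-upperMöbius : ∀ {n} (g : Subset n → ℚ) (X : Subset n) → Σₛ (λ Z → ⟦ X ⊆ Z ⟧ * upperMöbius g Z) ≡ g X
Σₛ-⊆-upperMöbius g X = begin
  Σₛ (λ Z → ⟦ X ⊆ Z ⟧ * (sign Z * Σₛ (λ S → ⟦ Z ⊆ S ⟧ * g̃ S)))
    ≡⟨ Σₛ-cong (λ Z → trans (sym (ℚ.*-assoc ⟦ X ⊆ Z ⟧ (sign Z) _)) (sym (Σₛ-*ˡ (⟦ X ⊆ Z ⟧ * sign Z) (λ S → ⟦ Z ⊆ S ⟧ * g̃ S)))) ⟩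
  Σₛ (λ Z → Σₛ (λ S → ⟦ X ⊆ Z ⟧ * sign Z * (⟦ Z ⊆ S ⟧ * g̃ S)))
    ≡⟨ Σₛ-comm (λ Z S → ⟦ X ⊆ Z ⟧ * sign Z * (⟦ Z ⊆ S ⟧ * g̃ S)) ⟩
  Σₛ (λ S → Σₛ (λ Z → ⟦ X ⊆ Z ⟧ * sign Z * (⟦ Z ⊆ S ⟧ * g̃ S)))
    ≡⟨ Σₛ-cong (λ S → trans (Σₛ-cong (λ Z → regroup ⟦ X ⊆ Z ⟧ (sign Z) ⟦ Z ⊆ S ⟧ (g̃ S)))
                             (Σₛ-*ˡ (g̃ S) (λ Z → ⟦ X ⊆ Z ⟧ * ⟦ Z ⊆ S ⟧ * sign Z))) ⟩
  Σₛ (λ S → g̃ S * Σₛ (λ Z → ⟦ X ⊆ Z ⟧ * ⟦ Z ⊆ S ⟧ * sign Z))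
    ≡⟨ Σₛ-cong (λ S → cong (g̃ S *_) (Σₛ-interval-sign X S)) ⟩
  Σₛ (λ S → (g S * sign S) * (sign S * ⟦ X ≡ S ⟧))
    ≡⟨ Σₛ-cong (λ S → solve 3 (λ a s d → (a :* s) :* (s :* d) := d :* (a :* (s :* s))) refl (g S) (sign S) ⟦ X ≡ S ⟧) ⟩
  Σₛ (λ S → ⟦ X ≡ S ⟧ * (g S * (sign S * sign S)))
    ≡⟨ Σₛ-⟦≡⟧ X (λ S → g S * (sign S * sign S)) ⟩
  g X * (sign X * sign X)
    ≡⟨ trans (cong (g X *_) (sign*sign≡1 X)) (ℚ.*-identityʳ (g X)) ⟩
  g X ∎
  where
  g̃ : Subset _ → ℚ
  g̃ S = g S * sign S
  regroup : ∀ a s b c → a * s * (b * c) ≡ c * (a * b * s)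
  regroup = solve 4 (λ a s b c → a :* s :* (b :* c) := c :* (a :* b :* s)) refl

upperMöbius-toggle-invariant : ∀ {n} (g : Subset n → ℚ) {A : Subset n} (e : Fin n) → e ∉ A →
                               (∀ S → A ⊆ S → g (toggle e S) ≡ g S) → upperMöbius g A ≡ 0ℚ
upperMöbius-toggle-invariant g {A} e e∉A g-invariant =
  trans (cong (sign A *_) ΣG≡0) (ℚ.*-zeroʳ (sign A))
  where
  G : Subset _ → ℚ
  G S = ⟦ A ⊆ S ⟧ * (g S * sign S)
  G-toggle : ∀ S → G (toggle e S) ≡ - G S
  G-toggle S with A ⊆? S
  ... | yes A⊆S = begin
    ⟦ A ⊆ toggle e S ⟧ * (g (toggle e S) * sign (toggle e S))
      ≡⟨ cong₂ _*_ (⟦⊆⟧-toggle e A S e∉A) (cong₂ _*_ (g-invariant S A⊆S) (sign-toggle e S)) ⟩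
    ⟦ A ⊆ S ⟧ * (g S * - sign S)
      ≡⟨ solve 3 (λ a b s → a :* (b :* (:- s)) := :- (a :* (b :* s))) refl ⟦ A ⊆ S ⟧ (g S) (sign S) ⟩
    - G S ∎
  ... | no A⊈S = begin
    ⟦ A ⊆ toggle e S ⟧ * (g (toggle e S) * sign (toggle e S))
      ≡⟨ cong (_* _) (trans (⟦⊆⟧-toggle e A S e∉A) (⟦⊆⟧-no A⊈S)) ⟩
    0ℚ * (g (toggle e S) * sign (toggle e S))
      ≡⟨ ℚ.*-zeroˡ (g (toggle e S) * sign (toggle e S)) ⟩
    0ℚ
      ≡⟨ solve 1 (λ a → con 0ℚ := :- (con 0ℚ :* a)) refl (g S * sign S) ⟩
    - (0ℚ * (g S * sign S))
      ≡⟨ cong (λ a → - (a * (g S * sign S))) (sym (⟦⊆⟧-no A⊈S)) ⟩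
    - G S ∎
  ΣG≡0 : Σₛ G ≡ 0ℚ
  ΣG≡0 = x≡-x⇒x≡0 (Σₛ G) (trans (sym (Σₛ-toggle e G)) (trans (Σₛ-cong G-toggle) (Σₛ-neg G)))

ℤtoℚ-+ : ∀ a b → ℤtoℚ (a ℤ.+ b) ≡ ℤtoℚ a + ℤtoℚ b
ℤtoℚ-+ a b = sym (begin
  ℤtoℚ a + ℤtoℚ b                 ≡⟨ cong₂ _+_ (as-mkℚ a) (as-mkℚ b) ⟩
  -- the sum of two normalised fractions with denominator 1 computes to this
  (a ℤ.* ℤ.1ℤ ℤ.+ b ℤ.* ℤ.1ℤ) / 1 ≡⟨ cong₂ (λ c d → (c ℤ.+ d) / 1) (ℤ.*-identityʳ a) (ℤ.*-identityʳ b) ⟩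
  ℤtoℚ (a ℤ.+ b)                  ∎)
  where
  as-mkℚ : ∀ z → ℤtoℚ z ≡ mkℚ z 0 (Coprime.sym (Coprime.1-coprimeTo ℤ.∣ z ∣))
  as-mkℚ z = ℚ.↥p/↧p≡p _

ℤtoℚ-neg : ∀ z → ℤtoℚ (ℤ.- z) ≡ - ℤtoℚ z
ℤtoℚ-neg (ℤ.+ 0)      = refl
ℤtoℚ-neg ℤ.+[1+ m ]   = refl
ℤtoℚ-neg ℤ.-[1+ m ]   = solve 1 (λ x → x := :- (:- x)) refl (ℤtoℚ ℤ.+[1+ m ])

ℤtoℚ-sum : (g : A → ℤ) (xs : List A) →
           ℤtoℚ (foldr ℤ._+_ ℤ.0ℤ (map g xs)) ≡ sumℚ (map (ℤtoℚ ∘ g) xs)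
ℤtoℚ-sum g []       = refl
ℤtoℚ-sum g (x ∷ xs) = trans (ℤtoℚ-+ (g x) _) (cong (ℤtoℚ (g x) +_) (ℤtoℚ-sum g xs))

^-+ : ∀ x m k → x ^ (m ℕ.+ k) ≡ x ^ m * x ^ k
^-+ x zero    k = sym (ℚ.*-identityˡ _)
^-+ x (suc m) k = trans (cong (x *_) (^-+ x m k)) (sym (ℚ.*-assoc x _ _))

^-distrib-* : ∀ x y k → (x * y) ^ k ≡ x ^ k * y ^ k
^-distrib-* x y zero    = refl
^-distrib-* x y (suc k) = trans (cong (x * y *_) (^-distrib-* x y k))
  (solve 4 (λ x y a b → x :* y :* (a :* b) := x :* a :* (y :* b)) refl x y (x ^ k) (y ^ k))

1^ : ∀ k → 1ℚ ^ k ≡ 1ℚ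
1^ zero    = refl
1^ (suc k) = trans (ℚ.*-identityˡ _) (1^ k)

^-inverse : ∀ {x y} k → x * y ≡ 1ℚ → x ^ k * y ^ k ≡ 1ℚ
^-inverse {x} {y} k xy≡1 = trans (sym (^-distrib-* x y k)) (trans (cong (_^ k) xy≡1) (1^ k))

^-∸ : ∀ {x y m k} → x * y ≡ 1ℚ → k ℕ.≤ m → x ^ (m ∸ k) ≡ x ^ m * y ^ k
^-∸ {x} {y} {m} {k} xy≡1 k≤m = sym (begin
  x ^ m * y ^ k                 ≡⟨ cong (λ j → x ^ j * y ^ k) (sym (ℕ.m∸n+n≡m k≤m)) ⟩
  x ^ (m ∸ k ℕ.+ k) * y ^ k     ≡⟨ cong (_* y ^ k) (^-+ x (m ∸ k) k) ⟩
  x ^ (m ∸ k) * x ^ k * y ^ k   ≡⟨ ℚ.*-assoc (x ^ (m ∸ k)) _ _ ⟩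
  x ^ (m ∸ k) * (x ^ k * y ^ k) ≡⟨ cong (x ^ (m ∸ k) *_) (^-inverse k xy≡1) ⟩
  x ^ (m ∸ k) * 1ℚ              ≡⟨ ℚ.*-identityʳ _ ⟩
  x ^ (m ∸ k) ∎)

0^-positive : ∀ {k} → 0 ℕ.< k → 0ℚ ^ k ≡ 0ℚ
0^-positive {suc k} _ = ℚ.*-zeroˡ (0ℚ ^ k)

[-1]^-∸ : ∀ {m k} → k ℕ.≤ m → (- 1ℚ) ^ (m ∸ k) ≡ (- 1ℚ) ^ m * (- 1ℚ) ^ k
[-1]^-∸ = ^-∸ refl

[-1]^-inverse : ∀ k → (- 1ℚ) ^ k * (- 1ℚ) ^ k ≡ 1ℚ
[-1]^-inverse k = ^-inverse k refl

[-1]^∣∣≡sign : ∀ {n} (S : Subset n) → (- 1ℚ) ^ ∣ S ∣ ≡ sign S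
[-1]^∣∣≡sign []            = refl
[-1]^∣∣≡sign (outside ∷ S) = [-1]^∣∣≡sign S
[-1]^∣∣≡sign (inside ∷ S)  =
  trans (cong ((- 1ℚ) *_) ([-1]^∣∣≡sign S)) (solve 1 (λ s → con (- 1ℚ) :* s := :- s) refl (sign S))

-- Flats and the Möbius function of L(M)

module _ {n : ℕ} (M : Matroid n) where

  private
    r : ℕ
    r = rank M

  rk≤rank : ∀ S → rk M S ℕ.≤ r
  rk≤rank S = rk-mono M ⊆⊤

  rk-∪⁅⁆-upward : ∀ {A S : Subset n} (e : Fin n) → A ⊆ S →
                  rk M (A ∪ ⁅ e ⁆) ℕ.≤ rk M A → rk M (S ∪ ⁅ e ⁆) ≡ rk M S
  rk-∪⁅⁆-upward {A} {S} e A⊆S rk[A∪e]≤rkA = ℕ.≤-antisym rk[S∪e]≤rkS (rk-mono M (p⊆p∪q ⁅ e ⁆))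
    where
    S∪e⊆S∪[A∪e] : S ∪ ⁅ e ⁆ ⊆ S ∪ (A ∪ ⁅ e ⁆)
    S∪e⊆S∪[A∪e] x∈S∪e with x∈p∪q⁻ S ⁅ e ⁆ x∈S∪e
    ... | inj₁ x∈S = x∈p∪q⁺ (inj₁ x∈S)
    ... | inj₂ x∈e = x∈p∪q⁺ (inj₂ (x∈p∪q⁺ (inj₂ x∈e)))
    A⊆S∩[A∪e] : A ⊆ S ∩ (A ∪ ⁅ e ⁆)
    A⊆S∩[A∪e] x∈A = x∈p∩q⁺ (A⊆S x∈A , x∈p∪q⁺ (inj₁ x∈A))
    rk[S∪e]≤rkS : rk M (S ∪ ⁅ e ⁆) ℕ.≤ rk M S
    rk[S∪e]≤rkS = ℕ.+-cancelʳ-≤ (rk M A) _ _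
      (ℕ.≤-trans (ℕ.+-mono-≤ (rk-mono M S∪e⊆S∪[A∪e]) (rk-mono M A⊆S∩[A∪e]))
      (ℕ.≤-trans (rk-submod M S (A ∪ ⁅ e ⁆))
                 (ℕ.+-monoʳ-≤ (rk M S) rk[A∪e]≤rkA)))

  rk-toggle : ∀ {A S : Subset n} {e : Fin n} → e ∉ A → rk M (A ∪ ⁅ e ⁆) ℕ.≤ rk M A → A ⊆ S →
              rk M (toggle e S) ≡ rk M S
  rk-toggle {A} {S} {e} e∉A rk[A∪e]≤rkA A⊆S = begin
    rk M (toggle e S)            ≡⟨ sym (rk-∪⁅⁆-upward e (⊆-toggle e∉A A⊆S) rk[A∪e]≤rkA) ⟩
    rk M (toggle e S ∪ ⁅ e ⁆)    ≡⟨ cong (rk M) (toggle-∪-⁅⁆ e S) ⟩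
    rk M (S ∪ ⁅ e ⁆)             ≡⟨ rk-∪⁅⁆-upward e A⊆S rk[A∪e]≤rkA ⟩
    rk M S ∎

  ¬IsFlat⇒∃ : ∀ {A} → ¬ IsFlat M A → ∃ λ e → e ∉ A × rk M (A ∪ ⁅ e ⁆) ℕ.≤ rk M A
  ¬IsFlat⇒∃ {A} ¬flat with ¬∀⟶∃¬ n _ (λ e → ¬? (e ∈? A) →-dec (rk M A ℕ.<? rk M (A ∪ ⁅ e ⁆))) ¬flat
  ... | e , ¬[e∉A⇒rk<] with e ∈? A
  ...   | yes e∈A = ⊥-elim (¬[e∉A⇒rk<] (λ e∉A → ⊥-elim (e∉A e∈A)))
  ...   | no  e∉A = e , e∉A , ℕ.≮⇒≥ (λ rk< → ¬[e∉A⇒rk<] (λ _ → rk<))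

  flat⊂⊤⇒rk≢rank : ∀ {X} → IsFlat M X → X ⊂ ⊤ → rk M X ≢ r
  flat⊂⊤⇒rk≢rank {X} flat (_ , x , _ , x∉X) = ℕ.<⇒≢ (ℕ.<-≤-trans (flat x x∉X) (rk≤rank (X ∪ ⁅ x ⁆)))

  spanning : Subset n → ℚ
  spanning S = 𝟙 (rk M S ℕ.≟ r)

  spanning-yes : ∀ {S} → rk M S ≡ r → spanning S ≡ 1ℚ
  spanning-yes {S} rkS≡r with rk M S ℕ.≟ r
  ... | yes _     = refl
  ... | no  rkS≢r = ⊥-elim (rkS≢r rkS≡r)

  spanning-no : ∀ {S} → rk M S ≢ r → spanning S ≡ 0ℚ
  spanning-no {S} rkS≢r with rk M S ℕ.≟ r
  ... | yes rkS≡r = ⊥-elim (rkS≢r rkS≡r)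
  ... | no  _     = refl

  -- μ̂ X = sign X * Σ_{S ⊇ X spanning} sign S; on flats it is μ(X, 1̂)
  μ̂ : Subset n → ℚ
  μ̂ = upperMöbius spanning

  μ̂-nonflat : ∀ {A} → ¬ IsFlat M A → μ̂ A ≡ 0ℚ
  μ̂-nonflat ¬flat with ¬IsFlat⇒∃ ¬flat
  ... | e , e∉A , rk[A∪e]≤rkA = upperMöbius-toggle-invariant spanning e e∉A
        (λ S A⊆S → cong (λ k → 𝟙 (k ℕ.≟ r)) (rk-toggle e∉A rk[A∪e]≤rkA A⊆S))

  𝟙-flat-μ̂ : ∀ c X → 𝟙 (isFlat? M X) * (c * μ̂ X) ≡ c * μ̂ X
  𝟙-flat-μ̂ c X with isFlat? M X
  ... | yes _    = ℚ.*-identityˡ _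
  ... | no ¬flat = begin
    0ℚ * (c * μ̂ X) ≡⟨ ℚ.*-zeroˡ (c * μ̂ X) ⟩
    0ℚ             ≡⟨ sym (ℚ.*-zeroʳ c) ⟩
    c * 0ℚ         ≡⟨ cong (c *_) (sym (μ̂-nonflat ¬flat)) ⟩
    c * μ̂ X        ∎

  μ̂-⊤ : μ̂ ⊤ ≡ 1ℚ
  μ̂-⊤ = begin
    μ̂ ⊤                         ≡⟨ sym (Σₛ-⟦≡⟧ ⊤ μ̂) ⟩
    Σₛ (λ Z → ⟦ ⊤ ≡ Z ⟧ * μ̂ Z)  ≡⟨ Σₛ-cong (λ Z → cong (_* μ̂ Z) (sym (⟦⊤⊆⟧≡⟦⊤≡⟧ Z))) ⟩
    Σₛ (λ Z → ⟦ ⊤ ⊆ Z ⟧ * μ̂ Z)  ≡⟨ Σₛ-⊆-upperMöbius spanning ⊤ ⟩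
    spanning ⊤                  ≡⟨ spanning-yes refl ⟩
    1ℚ ∎

  Σₛ-⊂-μ̂ : ∀ {X} → IsFlat M X → X ⊂ ⊤ → Σₛ (λ Z → 𝟙 (X ⊂? Z) * μ̂ Z) ≡ - μ̂ X
  Σₛ-⊂-μ̂ {X} flat X⊂⊤ = begin
    Σₛ (λ Z → 𝟙 (X ⊂? Z) * μ̂ Z)
      ≡⟨ Σₛ-cong (λ Z → trans (cong (_* μ̂ Z) (𝟙⊂?≡⟦⊆⟧-⟦≡⟧ X Z))
                   (solve 3 (λ a d m → (a :- d) :* m := a :* m :+ :- (d :* m)) refl ⟦ X ⊆ Z ⟧ ⟦ X ≡ Z ⟧ (μ̂ Z))) ⟩
    Σₛ (λ Z → ⟦ X ⊆ Z ⟧ * μ̂ Z + - (⟦ X ≡ Z ⟧ * μ̂ Z))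
      ≡⟨ trans (Σₛ-+ (λ Z → ⟦ X ⊆ Z ⟧ * μ̂ Z) _) (cong (Σₛ (λ Z → ⟦ X ⊆ Z ⟧ * μ̂ Z) +_) (Σₛ-neg (λ Z → ⟦ X ≡ Z ⟧ * μ̂ Z))) ⟩
    Σₛ (λ Z → ⟦ X ⊆ Z ⟧ * μ̂ Z) - Σₛ (λ Z → ⟦ X ≡ Z ⟧ * μ̂ Z)
      ≡⟨ cong₂ _-_ (Σₛ-⊆-upperMöbius spanning X) (Σₛ-⟦≡⟧ X μ̂) ⟩
    spanning X - μ̂ X
      ≡⟨ cong (_- μ̂ X) (spanning-no (flat⊂⊤⇒rk≢rank flat X⊂⊤)) ⟩
    0ℚ - μ̂ X
      ≡⟨ ℚ.+-identityˡ (- μ̂ X) ⟩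
    - μ̂ X ∎

  sumℚ-flats : ∀ (f : Subset n → ℚ) → sumℚ (map f (flats M)) ≡ Σₛ (λ X → 𝟙 (isFlat? M X) * f X)
  sumℚ-flats f = trans (sumℚ-filter {P = IsFlat M} (isFlat? M) f (allSubsets n)) (sumℚ-allSubsets n _)

  μ-fuel≡μ̂ : ∀ k X → IsFlat M X → n ∸ ∣ X ∣ ℕ.≤ k → ℤtoℚ (μ-fuel M k X) ≡ μ̂ X
  μ-fuel≡μ̂ zero    X _    n∸∣X∣≤0 = sym (trans (cong μ̂ X≡⊤) μ̂-⊤)
    where
    X≡⊤ : X ≡ ⊤
    X≡⊤ = ∣p∣≡n⇒p≡⊤ (ℕ.≤-antisym (∣p∣≤n X) (ℕ.m∸n≡0⇒m≤n (ℕ.n≤0⇒n≡0 n∸∣X∣≤0)))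
  μ-fuel≡μ̂ (suc k) X flat n∸∣X∣≤1+k with X ⊂? ⊤
  ... | no  X⊄⊤ = sym (trans (cong μ̂ (⊆∧⊄⇒≡ ⊆⊤ X⊄⊤)) μ̂-⊤)
  ... | yes X⊂⊤ = begin
    ℤtoℚ (ℤ.- foldr ℤ._+_ ℤ.0ℤ (map (μ-fuel M k) above))
      ≡⟨ trans (ℤtoℚ-neg (foldr ℤ._+_ ℤ.0ℤ (map (μ-fuel M k) above))) (cong -_ (ℤtoℚ-sum (μ-fuel M k) above)) ⟩
    - sumℚ (map (ℤtoℚ ∘ μ-fuel M k) above)
      ≡⟨ cong (-_ ∘ sumℚ) (map-cong-local (All.tabulate IH)) ⟩
    - sumℚ (map μ̂ (filter (X ⊂?_) (flats M)))
      ≡⟨ cong -_ (trans (sumℚ-filter (X ⊂?_) μ̂ (flats M)) (sumℚ-flats _)) ⟩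
    - Σₛ (λ Z → 𝟙 (isFlat? M Z) * (𝟙 (X ⊂? Z) * μ̂ Z))
      ≡⟨ cong -_ (Σₛ-cong (λ Z → 𝟙-flat-μ̂ (𝟙 (X ⊂? Z)) Z)) ⟩
    - Σₛ (λ Z → 𝟙 (X ⊂? Z) * μ̂ Z)
      ≡⟨ cong -_ (Σₛ-⊂-μ̂ flat X⊂⊤) ⟩
    - - μ̂ X
      ≡⟨ solve 1 (λ m → :- (:- m) := m) refl (μ̂ X) ⟩
    μ̂ X ∎
    where
    above : List (Subset n)
    above = filter (X ⊂?_) (flats M)
    IH : ∀ {Z} → Z ∈ₗ above → ℤtoℚ (μ-fuel M k Z) ≡ μ̂ Z
    IH Z∈above with ∈-filter⁻ (X ⊂?_) Z∈above
    ... | Z∈flats , X⊂Z = μ-fuel≡μ̂ k _ (proj₂ (∈-filter⁻ (isFlat? M) {xs = allSubsets n} Z∈flats))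
      (ℕ.≤-trans (ℕ.∸-monoʳ-≤ n (p⊂q⇒∣p∣<∣q∣ X⊂Z))
                 (subst (ℕ._≤ k) (ℕ.pred[m∸n]≡m∸[1+n] n ∣ X ∣) (ℕ.pred-mono-≤ n∸∣X∣≤1+k)))

  μTop≡μ̂ : ∀ {X} → IsFlat M X → ℤtoℚ (μTop M X) ≡ μ̂ X
  μTop≡μ̂ {X} flat = μ-fuel≡μ̂ n X flat (ℕ.m∸n≤m n ∣ X ∣)

  χop-summand : ℚ → Subset n → ℚ
  χop-summand s X = 𝟙 (isFlat? M X) * (ℤtoℚ (μTop M X) * s ^ rk M X)

  χop≡Σₛ : ∀ s → χop M s ≡ Σₛ (χop-summand s)
  χop≡Σₛ s = sumℚ-flats (λ X → ℤtoℚ (μTop M X) * s ^ rk M X)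

  -- the factor local to the definition of T², which is not exported
  factor : ℚ → ℚ → Subset n → ℚ
  factor x y S = ((x - 1ℚ) ^ (r ∸ rk M S)) * ((y - 1ℚ) ^ (∣ S ∣ ∸ rk M S))

  T²≡Σₛ : ∀ x₁ x₂ y₁ y₂ →
          T² M x₁ x₂ y₁ y₂ ≡ Σₛ (λ S₂ → Σₛ (λ S₁ → ⟦ S₁ ⊆ S₂ ⟧ * (factor x₁ y₁ S₁ * factor x₂ y₂ S₂)))
  T²≡Σₛ x₁ x₂ y₁ y₂ = begin
    sumℚ (map term (chains₂ n))
      ≡⟨ sumℚ-concatMap term (λ S₂ → map (_, S₂) (below S₂)) (allSubsets n) ⟩
    sumℚ (map (λ S₂ → sumℚ (map term (map (_, S₂) (below S₂)))) (allSubsets n))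
      ≡⟨ sumℚ-allSubsets n _ ⟩
    Σₛ (λ S₂ → sumℚ (map term (map (_, S₂) (below S₂))))
      ≡⟨ Σₛ-cong inner ⟩
    Σₛ (λ S₂ → Σₛ (λ S₁ → ⟦ S₁ ⊆ S₂ ⟧ * term (S₁ , S₂))) ∎
    where
    below : Subset n → List (Subset n)
    below S₂ = filter (_⊆? S₂) (allSubsets n)
    term : Subset n × Subset n → ℚ
    term p = factor x₁ y₁ (proj₁ p) * factor x₂ y₂ (proj₂ p)
    inner : ∀ S₂ → sumℚ (map term (map (_, S₂) (below S₂))) ≡ Σₛ (λ S₁ → ⟦ S₁ ⊆ S₂ ⟧ * term (S₁ , S₂))
    inner S₂ = begin
      sumℚ (map term (map (_, S₂) (below S₂)))           ≡⟨ cong sumℚ (sym (map-∘ (below S₂))) ⟩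
      sumℚ (map (λ S₁ → term (S₁ , S₂)) (below S₂))      ≡⟨ sumℚ-filter (_⊆? S₂) _ (allSubsets n) ⟩
      sumℚ (map (λ S₁ → 𝟙 (S₁ ⊆? S₂) * term (S₁ , S₂)) (allSubsets n))
        ≡⟨ sumℚ-allSubsets n _ ⟩
      Σₛ (λ S₁ → 𝟙 (S₁ ⊆? S₂) * term (S₁ , S₂))         ≡⟨ Σₛ-cong (λ S₁ → cong (_* term (S₁ , S₂)) (sym (⟦⊆⟧≡𝟙 S₁ S₂))) ⟩
      Σₛ (λ S₁ → ⟦ S₁ ⊆ S₂ ⟧ * term (S₁ , S₂)) ∎

  factor-at-[1-t,0] : ∀ t S → factor (1ℚ - t) 0ℚ S ≡ t ^ (r ∸ rk M S) * (sign S * (- 1ℚ) ^ r)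
  factor-at-[1-t,0] t S = begin
    (1ℚ - t - 1ℚ) ^ (r ∸ ρ) * (- 1ℚ) ^ (∣ S ∣ ∸ ρ)
      ≡⟨ cong (λ x → x ^ (r ∸ ρ) * (- 1ℚ) ^ (∣ S ∣ ∸ ρ)) (solve 1 (λ t → con 1ℚ :- t :- con 1ℚ := con (- 1ℚ) :* t) refl t) ⟩
    ((- 1ℚ) * t) ^ (r ∸ ρ) * (- 1ℚ) ^ (∣ S ∣ ∸ ρ)
      ≡⟨ cong₂ _*_ (^-distrib-* (- 1ℚ) t (r ∸ ρ)) ([-1]^-∸ (rk-bounded M S)) ⟩
    (- 1ℚ) ^ (r ∸ ρ) * t ^ (r ∸ ρ) * ((- 1ℚ) ^ ∣ S ∣ * (- 1ℚ) ^ ρ)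
      ≡⟨ cong₂ (λ a b → a * t ^ (r ∸ ρ) * (b * (- 1ℚ) ^ ρ)) ([-1]^-∸ (rk≤rank S)) ([-1]^∣∣≡sign S) ⟩
    (- 1ℚ) ^ r * (- 1ℚ) ^ ρ * t ^ (r ∸ ρ) * (sign S * (- 1ℚ) ^ ρ)
      ≡⟨ solve 4 (λ e u s g → e :* g :* u :* (s :* g) := u :* (s :* e) :* (g :* g)) refl
           ((- 1ℚ) ^ r) (t ^ (r ∸ ρ)) (sign S) ((- 1ℚ) ^ ρ) ⟩
    t ^ (r ∸ ρ) * (sign S * (- 1ℚ) ^ r) * ((- 1ℚ) ^ ρ * (- 1ℚ) ^ ρ)
      ≡⟨ trans (cong (t ^ (r ∸ ρ) * (sign S * (- 1ℚ) ^ r) *_) ([-1]^-inverse ρ)) (ℚ.*-identityʳ _) ⟩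
    t ^ (r ∸ ρ) * (sign S * (- 1ℚ) ^ r) ∎
    where
    ρ : ℕ
    ρ = rk M S

  factor-at-[1,0] : ∀ S → factor 1ℚ 0ℚ S ≡ spanning S * (sign S * (- 1ℚ) ^ r)
  factor-at-[1,0] S with rk M S ℕ.≟ r
  ... | yes ρ≡r = begin
    0ℚ ^ (r ∸ ρ) * (- 1ℚ) ^ (∣ S ∣ ∸ ρ)
      ≡⟨ cong₂ (λ j z → 0ℚ ^ j * z) (trans (cong (r ∸_) ρ≡r) (ℕ.n∸n≡0 r)) ([-1]^-∸ (rk-bounded M S)) ⟩
    1ℚ * ((- 1ℚ) ^ ∣ S ∣ * (- 1ℚ) ^ ρ)
      ≡⟨ cong₂ (λ a j → 1ℚ * (a * (- 1ℚ) ^ j)) ([-1]^∣∣≡sign S) ρ≡r ⟩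
    1ℚ * (sign S * (- 1ℚ) ^ r) ∎
    where
    ρ : ℕ
    ρ = rk M S
  ... | no ρ≢r = begin
    0ℚ ^ (r ∸ ρ) * (- 1ℚ) ^ (∣ S ∣ ∸ ρ)
      ≡⟨ cong (_* (- 1ℚ) ^ (∣ S ∣ ∸ ρ)) (0^-positive (ℕ.m<n⇒0<n∸m (ℕ.≤∧≢⇒< (rk≤rank S) ρ≢r))) ⟩
    0ℚ * (- 1ℚ) ^ (∣ S ∣ ∸ ρ)
      ≡⟨ trans (ℚ.*-zeroˡ ((- 1ℚ) ^ (∣ S ∣ ∸ ρ))) (sym (ℚ.*-zeroˡ (sign S * (- 1ℚ) ^ r))) ⟩
    0ℚ * (sign S * (- 1ℚ) ^ r) ∎
    where
    ρ : ℕ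
    ρ = rk M S

  T²-inner-sum : ∀ t S₁ → Σₛ (λ S₂ → ⟦ S₁ ⊆ S₂ ⟧ * (factor (1ℚ - t) 0ℚ S₁ * factor 1ℚ 0ℚ S₂)) ≡ t ^ (r ∸ rk M S₁) * μ̂ S₁
  T²-inner-sum t S₁ = begin
    Σₛ (λ S₂ → ⟦ S₁ ⊆ S₂ ⟧ * (factor (1ℚ - t) 0ℚ S₁ * factor 1ℚ 0ℚ S₂))
      ≡⟨ Σₛ-cong (λ S₂ → cong₂ (λ a b → ⟦ S₁ ⊆ S₂ ⟧ * (a * b)) (factor-at-[1-t,0] t S₁) (factor-at-[1,0] S₂)) ⟩
    Σₛ (λ S₂ → ⟦ S₁ ⊆ S₂ ⟧ * (u * (sign S₁ * ε) * (spanning S₂ * (sign S₂ * ε))))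
      ≡⟨ Σₛ-cong (λ S₂ → regroup ⟦ S₁ ⊆ S₂ ⟧ (spanning S₂) (sign S₂)) ⟩
    Σₛ (λ S₂ → u * sign S₁ * (ε * ε) * (⟦ S₁ ⊆ S₂ ⟧ * (spanning S₂ * sign S₂)))
      ≡⟨ Σₛ-*ˡ (u * sign S₁ * (ε * ε)) (λ S₂ → ⟦ S₁ ⊆ S₂ ⟧ * (spanning S₂ * sign S₂)) ⟩
    u * sign S₁ * (ε * ε) * Σₛ (λ S₂ → ⟦ S₁ ⊆ S₂ ⟧ * (spanning S₂ * sign S₂))
      ≡⟨ cong (λ z → u * sign S₁ * z * Σₛ (λ S₂ → ⟦ S₁ ⊆ S₂ ⟧ * (spanning S₂ * sign S₂))) ([-1]^-inverse r) ⟩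
    u * sign S₁ * 1ℚ * Σₛ (λ S₂ → ⟦ S₁ ⊆ S₂ ⟧ * (spanning S₂ * sign S₂))
      ≡⟨ solve 3 (λ u s σ → u :* s :* con 1ℚ :* σ := u :* (s :* σ)) refl u (sign S₁) _ ⟩
    u * μ̂ S₁ ∎
    where
    u ε : ℚ
    u = t ^ (r ∸ rk M S₁)
    ε = (- 1ℚ) ^ r
    regroup : ∀ d p σ → d * (u * (sign S₁ * ε) * (p * (σ * ε))) ≡ u * sign S₁ * (ε * ε) * (d * (p * σ))
    regroup = solve 6 (λ u s e d p σ → d :* (u :* (s :* e) :* (p :* (σ :* e))) := u :* s :* (e :* e) :* (d :* (p :* σ)))
                refl u (sign S₁) ε

  t^[r∸rk]*μ̂≡t^r*χop-summand : ∀ t .{{_ : NonZero t}} X → t ^ (r ∸ rk M X) * μ̂ X ≡ t ^ r * χop-summand (1/ t) X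
  t^[r∸rk]*μ̂≡t^r*χop-summand t X with isFlat? M X
  ... | yes flat = begin
    t ^ (r ∸ rk M X) * μ̂ X
      ≡⟨ cong₂ _*_ (^-∸ (ℚ.*-inverseʳ t) (rk≤rank X)) (sym (μTop≡μ̂ flat)) ⟩
    t ^ r * (1/ t) ^ rk M X * ℤtoℚ (μTop M X)
      ≡⟨ solve 3 (λ a b m → a :* b :* m := a :* (con 1ℚ :* (m :* b))) refl (t ^ r) ((1/ t) ^ rk M X) (ℤtoℚ (μTop M X)) ⟩
    t ^ r * (1ℚ * (ℤtoℚ (μTop M X) * (1/ t) ^ rk M X)) ∎
  ... | no ¬flat = begin
    t ^ (r ∸ rk M X) * μ̂ X
      ≡⟨ trans (cong (t ^ (r ∸ rk M X) *_) (μ̂-nonflat ¬flat)) (ℚ.*-zeroʳ (t ^ (r ∸ rk M X))) ⟩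
    0ℚ
      ≡⟨ solve 2 (λ a b → con 0ℚ := a :* (con 0ℚ :* b)) refl (t ^ r) (ℤtoℚ (μTop M X) * (1/ t) ^ rk M X) ⟩
    t ^ r * (0ℚ * (ℤtoℚ (μTop M X) * (1/ t) ^ rk M X)) ∎

proposition5p15 : ∀ {n : ℕ} (M : Matroid n) (t : ℚ) .{{_ : NonZero t}} →
    T² M (1ℚ - t) 1ℚ 0ℚ 0ℚ ≡ (t ^ rank M) * χop M (1/ t)
proposition5p15 M t = begin
  T² M (1ℚ - t) 1ℚ 0ℚ 0ℚ
    ≡⟨ T²≡Σₛ M (1ℚ - t) 1ℚ 0ℚ 0ℚ ⟩
  Σₛ (λ S₂ → Σₛ (λ S₁ → summand S₁ S₂))
    ≡⟨ Σₛ-comm (λ S₂ S₁ → summand S₁ S₂) ⟩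
  Σₛ (λ S₁ → Σₛ (λ S₂ → summand S₁ S₂))
    ≡⟨ Σₛ-cong (T²-inner-sum M t) ⟩
  Σₛ (λ X → t ^ (rank M ∸ rk M X) * μ̂ M X)
    ≡⟨ Σₛ-cong (t^[r∸rk]*μ̂≡t^r*χop-summand M t) ⟩
  Σₛ (λ X → t ^ rank M * χop-summand M (1/ t) X)
    ≡⟨ Σₛ-*ˡ (t ^ rank M) (χop-summand M (1/ t)) ⟩
  t ^ rank M * Σₛ (χop-summand M (1/ t))
    ≡⟨ cong (t ^ rank M *_) (sym (χop≡Σₛ M (1/ t))) ⟩
  t ^ rank M * χop M (1/ t) ∎
  where
  summand : Subset _ → Subset _ → ℚ
  summand S₁ S₂ = ⟦ S₁ ⊆ S₂ ⟧ * (factor M (1ℚ - t) 0ℚ S₁ * factor M 1ℚ 0ℚ S₂)
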